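{- Let $\mathbf{d}=d_0d_1d_2\cdots\in\{ -1,1\}^{\infty}$ and let $\mathbf{c}=c_0c_1c_2\cdots\in\{0,1\}^{\infty}$ with $c_i\equiv\frac{d_i-d_{i+2}}{2}\pmod 2$ for all $i\geq 0$. Then $\mathbf{d}$ is ($\pm1$) apwenian if and only if $\mathbf{c}$ is ($0$-$1$) apwenian.
   Context: For an integer sequence $\mathbf{a}$, $H_n(\mathbf{a})=\det(a_{i+j})_{0\leq i,j\leq n-1}$. A sequence $\mathbf{d}\in\{ -1,1\}^{\infty}$ is ($\pm1$) apwenian if $H_n(\mathbf{d})/2^{n-1}\equiv 1\pmod 2$ for all $n\geq 1$; a sequence $\mathbf{c}\in\{0,1\}^{\infty}$ is ($0$-$1$) apwenian if $H_n(\mathbf{c})\equiv 1\pmod 2$ for all $n\geq 1$. -}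

module Defs where

open import Data.Nat using (ℕ; zero; suc)
open import Data.Integer using (ℤ; +_; _+_; _-_; _*_; -_; 0ℤ; 1ℤ)
open import Data.Integer.Divisibility using (_∣_)
open import Data.Fin using (Fin; zero; suc; toℕ; punchIn)
open import Data.Product using (∃; _×_)
open import Data.Sum using (_⊎_)
open import Relation.Binary.PropositionalEquality using (_≡_)

Σᶠ : ∀ {n} → (Fin n → ℤ) → ℤ
Σᶠ {zero}  f = 0ℤ
Σᶠ {suc n} f = f zero + Σᶠ (λ i → f (suc i))

sgn : ℕ → ℤ
sgn zero = 1ℤ
sgn (suc k) = - sgn k

det : ∀ n → (Fin n → Fin n → ℤ) → ℤ
det zero    M = 1ℤ
det (suc n) M =
  Σᶠ (λ j → sgn (toℕ j) * M zero j * det n (λ r s → M (suc r) (punchIn j s)))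

H : ℕ → (ℕ → ℤ) → ℤ
H n a = det n (λ i j → a (toℕ i Data.Nat.+ toℕ j))

pow2 : ℕ → ℤ
pow2 zero = 1ℤ
pow2 (suc m) = + 2 * pow2 m

Odd : ℤ → Set
Odd x = ∃ λ k → x ≡ + 2 * k + 1ℤ

PM1Seq : (ℕ → ℤ) → Set
PM1Seq d = ∀ i → d i ≡ 1ℤ ⊎ d i ≡ - 1ℤ

ZeroOneSeq : (ℕ → ℤ) → Set
ZeroOneSeq c = ∀ i → c i ≡ 0ℤ ⊎ c i ≡ 1ℤ

-- (±1) apwenian: H_n(d)/2^(n-1) is an odd integer for all n ≥ 1
-- (i.e. H_n(d) = 2^(n-1) * q with q odd)
ApwenianPM : (ℕ → ℤ) → Set
ApwenianPM d = ∀ n → ∃ λ q → H (suc n) d ≡ pow2 n * q × Odd q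

Apwenian01 : (ℕ → ℤ) → Set
Apwenian01 c = ∀ n → Odd (H (suc n) c)

-- c_i ≡ (d_i - d_{i+2})/2 (mod 2), i.e. c_i - (d_i - d_{i+2})/2 is even,
-- stated without division: 4 ∣ 2 c_i - (d_i - d_{i+2})
Related : (ℕ → ℤ) → (ℕ → ℤ) → Set
Related d c = ∀ i → + 4 ∣ (+ 2 * c i - (d i - d (suc (suc i))))

module Submission where

-- Write d = 1 - 2e. Subtracting from each row of (d_{i+j}) the row above it makes every row but the
-- first divisible by 2, so H_{n+1}(d) = 2^n X_n where X_n is the determinant of the matrix with first
-- row (d_j) and further rows (e_{i+j} - e_{i+j+1}). Modulo 2 the first row is (1, 1, …); subtracting
-- from each column the one to its left turns it into (1, 0, 0, …) and the remaining block into
-- (e_{i+j+2} - e_{i+j}) ≡ (c_{i+j}), so X_n ≡ H_n(c) (mod 2). Both apwenian conditions thus say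
-- that every X_n is odd.

open import Defs
open import Data.Integer using (ℤ)
open import Data.Nat using (ℕ)
open import Function.Bundles using (_⇔_; mk⇔)

open import Data.Nat using (zero; suc; _≤_; _<_; _<?_; s≤s; z<s) renaming (_+_ to _+ℕ_)
open import Relation.Binary.Definitions using (tri<; tri≈; tri>)
import Data.Nat.Properties as ℕ
open import Data.Integer using (+_; _+_; _-_; _*_; -_; 0ℤ; 1ℤ)
import Data.Integer.Properties as ℤ
open import Data.Integer.Divisibility.Signed using (divides; ∣ᵤ⇒∣)
open import Data.Integer.Tactic.RingSolver using (solve-∀)
open import Data.Fin using (Fin; zero; suc; toℕ; fromℕ<; punchIn; _≟_)
import Data.Fin.Properties as Fin
open import Data.Bool using (if_then_else_)
open import Data.Product using (∃; _×_; _,_)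
open import Data.Sum using (_⊎_; inj₁; inj₂)
open import Function using (_∘_)
import Function.Properties.Equivalence as ⇔
open import Relation.Nullary using (¬_; yes; no; does; contradiction)
open import Relation.Binary.PropositionalEquality
open ≡-Reasoning

Σᶠ-cong : ∀ {n} {f g : Fin n → ℤ} → (∀ i → f i ≡ g i) → Σᶠ f ≡ Σᶠ g
Σᶠ-cong {zero}  f≗g = refl
Σᶠ-cong {suc n} f≗g = cong₂ _+_ (f≗g zero) (Σᶠ-cong (f≗g ∘ suc))

Σᶠ-zero : ∀ {n} {f : Fin n → ℤ} → (∀ i → f i ≡ 0ℤ) → Σᶠ f ≡ 0ℤ
Σᶠ-zero {zero}  f≗0 = refl
Σᶠ-zero {suc n} f≗0 = cong₂ _+_ (f≗0 zero) (Σᶠ-zero (f≗0 ∘ suc))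

Σᶠ-+ : ∀ {n} (f g : Fin n → ℤ) → Σᶠ (λ i → f i + g i) ≡ Σᶠ f + Σᶠ g
Σᶠ-+ {zero}  f g = refl
Σᶠ-+ {suc n} f g =
  trans (cong (_+_ (f zero + g zero)) (Σᶠ-+ (f ∘ suc) (g ∘ suc)))
        (interchange (f zero) (g zero) (Σᶠ (f ∘ suc)) (Σᶠ (g ∘ suc)))
  where
  interchange : ∀ a b c d → (a + b) + (c + d) ≡ (a + c) + (b + d)
  interchange = solve-∀

*-distribˡ-Σᶠ : ∀ {n} a (f : Fin n → ℤ) → a * Σᶠ f ≡ Σᶠ (λ i → a * f i)
*-distribˡ-Σᶠ {zero}  a f = ℤ.*-zeroʳ a
*-distribˡ-Σᶠ {suc n} a f =
  trans (ℤ.*-distribˡ-+ a (f zero) _) (cong (_+_ (a * f zero)) (*-distribˡ-Σᶠ a (f ∘ suc)))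

Σᶠ-neg : ∀ {n} (f : Fin n → ℤ) → Σᶠ (λ i → - f i) ≡ - Σᶠ f
Σᶠ-neg {zero}  f = refl
Σᶠ-neg {suc n} f =
  trans (cong (_+_ (- f zero)) (Σᶠ-neg (f ∘ suc))) (sym (ℤ.neg-distrib-+ (f zero) _))

Σᶠ-linear : ∀ {n} t (f g : Fin n → ℤ) → Σᶠ (λ i → f i + t * g i) ≡ Σᶠ f + t * Σᶠ g
Σᶠ-linear t f g =
  trans (Σᶠ-+ f (λ i → t * g i)) (cong (_+_ (Σᶠ f)) (sym (*-distribˡ-Σᶠ t g)))

Σᶠ-comm : ∀ {m n} (f : Fin m → Fin n → ℤ) →
  Σᶠ (λ i → Σᶠ (λ j → f i j)) ≡ Σᶠ (λ j → Σᶠ (λ i → f i j))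
Σᶠ-comm {zero}  {n} f = sym (Σᶠ-zero {n} (λ _ → refl))
Σᶠ-comm {suc m}     f =
  trans (cong (_+_ (Σᶠ (f zero))) (Σᶠ-comm (f ∘ suc))) (sym (Σᶠ-+ (f zero) _))

Σᶠ-*-Σᶠ-comm : ∀ {m n} (a : Fin n → ℤ) (a′ : Fin m → ℤ) (f g : Fin m → Fin n → ℤ) →
  (∀ i j → a j * f i j ≡ a′ i * g i j) →
  Σᶠ (λ j → a j * Σᶠ (λ i → f i j)) ≡ Σᶠ (λ i → a′ i * Σᶠ (λ j → g i j))
Σᶠ-*-Σᶠ-comm a a′ f g eq = begin
    Σᶠ (λ j → a j * Σᶠ (λ i → f i j))
  ≡⟨ Σᶠ-cong (λ j → *-distribˡ-Σᶠ (a j) (λ i → f i j)) ⟩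
    Σᶠ (λ j → Σᶠ (λ i → a j * f i j))
  ≡⟨ Σᶠ-comm (λ j i → a j * f i j) ⟩
    Σᶠ (λ i → Σᶠ (λ j → a j * f i j))
  ≡⟨ Σᶠ-cong (λ i → Σᶠ-cong (eq i)) ⟩
    Σᶠ (λ i → Σᶠ (λ j → a′ i * g i j))
  ≡⟨ Σᶠ-cong (λ i → *-distribˡ-Σᶠ (a′ i) (g i)) ⟨
    Σᶠ (λ i → a′ i * Σᶠ (λ j → g i j))
  ∎

-- Determinants

Matrix : ℕ → Set
Matrix n = Fin n → Fin n → ℤ

minor : ∀ {n} → Matrix (suc n) → Fin (suc n) → Matrix n
minor A j r s = A (suc r) (punchIn j s)

colMinor : ∀ {n} → Matrix (suc n) → Fin (suc n) → Matrix n
colMinor A i r s = A (punchIn i r) (suc s)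

transpose : ∀ {n} → Matrix n → Matrix n
transpose A i j = A j i

det-cong : ∀ n {A B : Matrix n} → (∀ i j → A i j ≡ B i j) → det n A ≡ det n B
det-cong zero    A≗B = refl
det-cong (suc n) A≗B = Σᶠ-cong λ j →
  cong₂ (λ a D → sgn (toℕ j) * a * D) (A≗B zero j) (det-cong n (λ r s → A≗B (suc r) (punchIn j s)))

colTerm : ∀ {n} → Matrix (suc n) → Fin (suc n) → ℤ
colTerm {n} A i = sgn (toℕ i) * A i zero * det n (colMinor A i)

detᶜ : ∀ n → Matrix (suc n) → ℤ
detᶜ n A = Σᶠ (colTerm A)

-- Both double expansions run over the same minors D i j with row 0 and column 0 deleted.
det≡detᶜ : ∀ n (A : Matrix (suc n)) → det (suc n) A ≡ detᶜ n A
det≡detᶜ zero    A = refl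
det≡detᶜ (suc m) A = cong (_+_ (1ℤ * A zero zero * det (suc m) (minor A zero))) (begin
    Σᶠ (λ j → sgn (toℕ (suc j)) * A zero (suc j) * det (suc m) (minor A (suc j)))
  ≡⟨ Σᶠ-cong (λ j → cong (_*_ (sgn (toℕ (suc j)) * A zero (suc j))) (det≡detᶜ m (minor A (suc j)))) ⟩
    Σᶠ (λ j → sgn (toℕ (suc j)) * A zero (suc j) * Σᶠ (λ i → sgn (toℕ i) * A (suc i) zero * D i j))
  ≡⟨ Σᶠ-*-Σᶠ-comm (λ j → sgn (toℕ (suc j)) * A zero (suc j))
                   (λ i → sgn (toℕ (suc i)) * A (suc i) zero)
       (λ i j → sgn (toℕ i) * A (suc i) zero * D i j) (λ i j → sgn (toℕ j) * A zero (suc j) * D i j)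
       (λ i j → swapSigns (sgn (toℕ j)) (A zero (suc j)) (sgn (toℕ i)) (A (suc i) zero) (D i j)) ⟩
    Σᶠ (λ i → sgn (toℕ (suc i)) * A (suc i) zero * Σᶠ (λ j → sgn (toℕ j) * A zero (suc j) * D i j))
  ∎)
  where
  D : Fin (suc m) → Fin (suc m) → ℤ
  D i j = det m (λ r s → A (suc (punchIn i r)) (suc (punchIn j s)))
  swapSigns : ∀ σ a τ b x → - σ * a * (τ * b * x) ≡ - τ * b * (σ * a * x)
  swapSigns = solve-∀

det-transpose : ∀ n (A : Matrix n) → det n (transpose A) ≡ det n A
det-transpose zero    A = refl
det-transpose (suc n) A = trans
  (Σᶠ-cong λ j → cong (_*_ (sgn (toℕ j) * A j zero)) (det-transpose n (colMinor A j)))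
  (sym (det≡detᶜ n A))

swap₀₁ : ∀ {m} → Matrix (suc (suc m)) → Matrix (suc (suc m))
swap₀₁ A zero          = A (suc zero)
swap₀₁ A (suc zero)    = A zero
swap₀₁ A (suc (suc r)) = A (suc (suc r))

colTail : ∀ m → Matrix (suc (suc m)) → ℤ
colTail m A = Σᶠ (λ i → colTerm A (suc (suc i)))

-- Expand along the first column: the swap exchanges the first two terms and, by induction,
-- negates every later one.
mutual
  det-swap₀₁ : ∀ m (A : Matrix (suc (suc m))) → det (suc (suc m)) (swap₀₁ A) ≡ - det (suc (suc m)) A
  det-swap₀₁ m A = begin
      det (suc (suc m)) (swap₀₁ A)
    ≡⟨ det≡detᶜ (suc m) (swap₀₁ A) ⟩
      1ℤ * A (suc zero) zero * det (suc m) (colMinor (swap₀₁ A) zero)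
        + (- 1ℤ * A zero zero * det (suc m) (colMinor (swap₀₁ A) (suc zero)) + colTail m (swap₀₁ A))
    ≡⟨ cong₂ (λ Q′ P′ → 1ℤ * A (suc zero) zero * Q′
                          + (- 1ℤ * A zero zero * P′ + colTail m (swap₀₁ A)))
         (det-cong (suc m) {colMinor (swap₀₁ A) zero} {colMinor A (suc zero)}
            λ { zero s → refl ; (suc r) s → refl })
         (det-cong (suc m) {colMinor (swap₀₁ A) (suc zero)} {colMinor A zero}
            λ { zero s → refl ; (suc r) s → refl }) ⟩
      1ℤ * A (suc zero) zero * Q + (- 1ℤ * A zero zero * P + colTail m (swap₀₁ A))
    ≡⟨ cong (λ T → 1ℤ * A (suc zero) zero * Q + (- 1ℤ * A zero zero * P + T)) (colTail-swap₀₁ m A) ⟩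
      1ℤ * A (suc zero) zero * Q + (- 1ℤ * A zero zero * P + - colTail m A)
    ≡⟨ antisymmetry (A zero zero) (A (suc zero) zero) P Q (colTail m A) ⟩
      - (1ℤ * A zero zero * P + (- 1ℤ * A (suc zero) zero * Q + colTail m A))
    ≡⟨ cong -_ (det≡detᶜ (suc m) A) ⟨
      - det (suc (suc m)) A
    ∎
    where
    P Q : ℤ
    P = det (suc m) (colMinor A zero)
    Q = det (suc m) (colMinor A (suc zero))
    antisymmetry : ∀ a b P Q T → 1ℤ * b * Q + (- 1ℤ * a * P + - T) ≡ - (1ℤ * a * P + (- 1ℤ * b * Q + T))
    antisymmetry = solve-∀

  colTail-swap₀₁ : ∀ m (A : Matrix (suc (suc m))) → colTail m (swap₀₁ A) ≡ - colTail m A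
  colTail-swap₀₁ zero    A = refl
  colTail-swap₀₁ (suc m) A = trans (Σᶠ-cong term-swap) (Σᶠ-neg (λ i → colTerm A (suc (suc i))))
    where
    term-swap : ∀ i → colTerm (swap₀₁ A) (suc (suc i)) ≡ - colTerm A (suc (suc i))
    term-swap i = begin
        a * det (suc (suc m)) (colMinor (swap₀₁ A) (suc (suc i)))
      ≡⟨ cong (_*_ a) (det-cong (suc (suc m))
           {colMinor (swap₀₁ A) (suc (suc i))} {swap₀₁ (colMinor A (suc (suc i)))}
           λ { zero s → refl ; (suc zero) s → refl ; (suc (suc r)) s → refl }) ⟩
        a * det (suc (suc m)) (swap₀₁ (colMinor A (suc (suc i))))
      ≡⟨ cong (_*_ a) (det-swap₀₁ m (colMinor A (suc (suc i)))) ⟩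
        a * - det (suc (suc m)) (colMinor A (suc (suc i)))
      ≡⟨ ℤ.neg-distribʳ-* a _ ⟨
        - (a * det (suc (suc m)) (colMinor A (suc (suc i))))
      ∎
      where
      a : ℤ
      a = sgn (toℕ (suc (suc i))) * A (suc (suc i)) zero

x≡-x⇒x≡0 : ∀ {x} → x ≡ - x → x ≡ 0ℤ
x≡-x⇒x≡0 {x} x≡-x = ℤ.*-cancelˡ-≡ (+ 2) x 0ℤ (begin
  + 2 * x  ≡⟨ double x ⟩
  x + x    ≡⟨ cong (_+_ x) x≡-x ⟩
  x + - x  ≡⟨ ℤ.+-inverseʳ x ⟩
  0ℤ       ∎)
  where
  double : ∀ x → + 2 * x ≡ x + x
  double = solve-∀

mutual
  det-≡-rowsˢ : ∀ n (A : Matrix (suc n)) {r s} → r ≢ s → (∀ j → A (suc r) j ≡ A (suc s) j) →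
    det (suc n) A ≡ 0ℤ
  det-≡-rowsˢ n A r≢s rows≡ = Σᶠ-zero λ j →
    trans (cong (_*_ (sgn (toℕ j) * A zero j)) (det-≡-rows n (minor A j) r≢s (rows≡ ∘ punchIn j)))
          (ℤ.*-zeroʳ (sgn (toℕ j) * A zero j))

  det-≡-rows₀ : ∀ n (A : Matrix (suc n)) s → (∀ j → A zero j ≡ A (suc s) j) → det (suc n) A ≡ 0ℤ
  det-≡-rows₀ (suc m) A zero    rows≡ =
    x≡-x⇒x≡0 (trans (det-cong (suc (suc m)) swap≗A) (det-swap₀₁ m A))
    where
    swap≗A : ∀ i j → A i j ≡ swap₀₁ A i j
    swap≗A zero          j = rows≡ j
    swap≗A (suc zero)    j = sym (rows≡ j)
    swap≗A (suc (suc r)) j = refl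
  det-≡-rows₀ (suc m) A (suc s) rows≡ = begin
      det (suc (suc m)) A
    ≡⟨ ℤ.neg-involutive _ ⟨
      - - det (suc (suc m)) A
    ≡⟨ cong -_ (det-swap₀₁ m A) ⟨
      - det (suc (suc m)) (swap₀₁ A)
    ≡⟨ cong -_ (det-≡-rowsˢ (suc m) (swap₀₁ A) {zero} {suc s} (λ ()) rows≡) ⟩
      0ℤ
    ∎

  det-≡-rows : ∀ n (A : Matrix n) {r s} → r ≢ s → (∀ j → A r j ≡ A s j) → det n A ≡ 0ℤ
  det-≡-rows (suc n) A {zero}  {zero}  r≢s rows≡ = contradiction refl r≢s
  det-≡-rows (suc n) A {zero}  {suc s} r≢s rows≡ = det-≡-rows₀ n A s rows≡
  det-≡-rows (suc n) A {suc r} {zero}  r≢s rows≡ = det-≡-rows₀ n A r (sym ∘ rows≡)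
  det-≡-rows (suc n) A {suc r} {suc s} r≢s rows≡ = det-≡-rowsˢ n A (r≢s ∘ cong suc) rows≡

replaceRow : ∀ {n} → Matrix n → Fin n → (Fin n → ℤ) → Matrix n
replaceRow A r v i j = if does (i ≟ r) then v j else A i j

replaceRow-here : ∀ {n} (A : Matrix n) r v j → replaceRow A r v r j ≡ v j
replaceRow-here A r v j with r ≟ r
... | yes _   = refl
... | no r≢r = contradiction refl r≢r

replaceRow-there : ∀ {n} (A : Matrix n) {r i} v → i ≢ r → ∀ j → replaceRow A r v i j ≡ A i j
replaceRow-there A {r} {i} v i≢r j with i ≟ r
... | yes i≡r = contradiction i≡r i≢r
... | no _    = refl

replaceRow-self : ∀ {n} (A : Matrix n) r i j → replaceRow A r (A r) i j ≡ A i j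
replaceRow-self A r i j with i ≟ r
... | yes refl = refl
... | no _     = refl

det-replaceRow-linear : ∀ n (A : Matrix n) r (u v : Fin n → ℤ) t →
  det n (replaceRow A r (λ j → u j + t * v j)) ≡ det n (replaceRow A r u) + t * det n (replaceRow A r v)
det-replaceRow-linear (suc n) A zero u v t = trans
  (Σᶠ-cong λ j → distrib (sgn (toℕ j)) (u j) (v j) t (det n (minor A j)))
  (Σᶠ-linear t (λ j → sgn (toℕ j) * u j * det n (minor A j)) (λ j → sgn (toℕ j) * v j * det n (minor A j)))
  where
  distrib : ∀ σ x y t D → σ * (x + t * y) * D ≡ σ * x * D + t * (σ * y * D)
  distrib = solve-∀
det-replaceRow-linear (suc n) A (suc r) u v t = trans
  (Σᶠ-cong λ j → trans
     (cong (_*_ (sgn (toℕ j) * A zero j))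
           (det-replaceRow-linear n (minor A j) r (u ∘ punchIn j) (v ∘ punchIn j) t))
     (distrib (sgn (toℕ j) * A zero j) (det n (replaceRow (minor A j) r (u ∘ punchIn j))) t
                                         (det n (replaceRow (minor A j) r (v ∘ punchIn j)))))
  (Σᶠ-linear t (λ j → sgn (toℕ j) * A zero j * det n (replaceRow (minor A j) r (u ∘ punchIn j)))
               (λ j → sgn (toℕ j) * A zero j * det n (replaceRow (minor A j) r (v ∘ punchIn j))))
  where
  distrib : ∀ a x t y → a * (x + t * y) ≡ a * x + t * (a * y)
  distrib = solve-∀

det-addRow : ∀ n (A : Matrix n) {r s} t → r ≢ s →
  det n (replaceRow A r (λ j → A r j + t * A s j)) ≡ det n A
det-addRow n A {r} {s} t r≢s = begin
    det n (replaceRow A r (λ j → A r j + t * A s j))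
  ≡⟨ det-replaceRow-linear n A r (A r) (A s) t ⟩
    det n (replaceRow A r (A r)) + t * det n (replaceRow A r (A s))
  ≡⟨ cong₂ (λ x y → x + t * y) (det-cong n (replaceRow-self A r)) (det-≡-rows n _ r≢s rowsᵣₛ) ⟩
    det n A + t * 0ℤ
  ≡⟨ trans (cong (_+_ (det n A)) (ℤ.*-zeroʳ t)) (ℤ.+-identityʳ _) ⟩
    det n A
  ∎
  where
  rowsᵣₛ : ∀ j → replaceRow A r (A s) r j ≡ replaceRow A r (A s) s j
  rowsᵣₛ j = trans (replaceRow-here A r (A s) j) (sym (replaceRow-there A (A s) (r≢s ∘ sym) j))

mutual
  det-*2 : ∀ n {A G : Matrix n} → (∀ i j → A i j ≡ + 2 * G i j) → det n A ≡ pow2 n * det n G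
  det-*2 zero    _    = refl
  det-*2 (suc n) {A} {G} A≡2G = det-*2-tail n {A} {G} {+ 2} (A≡2G zero) (A≡2G ∘ suc)

  det-*2-tail : ∀ n {A G : Matrix (suc n)} {a} → (∀ j → A zero j ≡ a * G zero j) →
    (∀ i j → A (suc i) j ≡ + 2 * G (suc i) j) → det (suc n) A ≡ a * pow2 n * det (suc n) G
  det-*2-tail n {A} {G} {a} row₀ rowsₛ = begin
      Σᶠ (λ j → sgn (toℕ j) * A zero j * det n (minor A j))
    ≡⟨ Σᶠ-cong (λ j → cong₂ (λ x D → sgn (toℕ j) * x * D)
                            (row₀ j) (det-*2 n (λ r s → rowsₛ r (punchIn j s)))) ⟩
      Σᶠ (λ j → sgn (toℕ j) * (a * G zero j) * (pow2 n * det n (minor G j)))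
    ≡⟨ Σᶠ-cong (λ j → pull (sgn (toℕ j)) a (G zero j) (pow2 n) (det n (minor G j))) ⟩
      Σᶠ (λ j → a * pow2 n * (sgn (toℕ j) * G zero j * det n (minor G j)))
    ≡⟨ *-distribˡ-Σᶠ (a * pow2 n) (λ j → sgn (toℕ j) * G zero j * det n (minor G j)) ⟨
      a * pow2 n * det (suc n) G
    ∎
    where
    pull : ∀ σ a g p D → σ * (a * g) * (p * D) ≡ a * p * (σ * g * D)
    pull = solve-∀

det-unitRow₀ : ∀ n {A : Matrix (suc n)} → A zero zero ≡ 1ℤ → (∀ j → A zero (suc j) ≡ 0ℤ) →
  det (suc n) A ≡ det n (minor A zero)
det-unitRow₀ n {A} a₀₀≡1 a₀ⱼ≡0 = begin
    1ℤ * A zero zero * det n (minor A zero)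
      + Σᶠ (λ j → sgn (toℕ (suc j)) * A zero (suc j) * det n (minor A (suc j)))
  ≡⟨ cong₂ (λ a T → 1ℤ * a * det n (minor A zero) + T) a₀₀≡1 (Σᶠ-zero vanish) ⟩
    1ℤ * 1ℤ * det n (minor A zero) + 0ℤ
  ≡⟨ trans (ℤ.+-identityʳ _) (ℤ.*-identityˡ _) ⟩
    det n (minor A zero)
  ∎
  where
  annihilate : ∀ σ D → σ * 0ℤ * D ≡ 0ℤ
  annihilate = solve-∀
  vanish : ∀ j → sgn (toℕ (suc j)) * A zero (suc j) * det n (minor A (suc j)) ≡ 0ℤ
  vanish j = trans (cong (λ a → sgn (toℕ (suc j)) * a * det n (minor A (suc j))) (a₀ⱼ≡0 j))
                   (annihilate (sgn (toℕ (suc j))) (det n (minor A (suc j))))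

-- Congruence modulo 2

infix 4 _≡₂_
record _≡₂_ (a b : ℤ) : Set where
  constructor mod2
  field
    quotient : ℤ
    equality : a ≡ b + + 2 * quotient

≡⇒≡₂ : ∀ {a b} → a ≡ b → a ≡₂ b
≡⇒≡₂ {a} refl = mod2 0ℤ (sym (ℤ.+-identityʳ a))

≡₂-refl : ∀ {a} → a ≡₂ a
≡₂-refl = ≡⇒≡₂ refl

≡₂-sym : ∀ {a b} → a ≡₂ b → b ≡₂ a
≡₂-sym {b = b} (mod2 k refl) = mod2 (- k) (shift b k)
  where
  shift : ∀ b k → b ≡ b + + 2 * k + + 2 * - k
  shift = solve-∀

≡₂-trans : ∀ {a b c} → a ≡₂ b → b ≡₂ c → a ≡₂ c
≡₂-trans {c = c} (mod2 k refl) (mod2 l refl) = mod2 (l + k) (regroup c l k)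
  where
  regroup : ∀ c l k → c + + 2 * l + + 2 * k ≡ c + + 2 * (l + k)
  regroup = solve-∀

≡₂-+ : ∀ {a b c d} → a ≡₂ b → c ≡₂ d → a + c ≡₂ b + d
≡₂-+ {b = b} {d = d} (mod2 k refl) (mod2 l refl) = mod2 (k + l) (regroup b d k l)
  where
  regroup : ∀ b d k l → b + + 2 * k + (d + + 2 * l) ≡ b + d + + 2 * (k + l)
  regroup = solve-∀

≡₂-* : ∀ {a b c d} → a ≡₂ b → c ≡₂ d → a * c ≡₂ b * d
≡₂-* {b = b} {d = d} (mod2 k refl) (mod2 l refl) = mod2 (b * l + k * d + + 2 * k * l) (expand b d k l)
  where
  expand : ∀ b d k l → (b + + 2 * k) * (d + + 2 * l) ≡ b * d + + 2 * (b * l + k * d + + 2 * k * l)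
  expand = solve-∀

Σᶠ-cong-≡₂ : ∀ {n} {f g : Fin n → ℤ} → (∀ i → f i ≡₂ g i) → Σᶠ f ≡₂ Σᶠ g
Σᶠ-cong-≡₂ {zero}  f≡₂g = ≡₂-refl
Σᶠ-cong-≡₂ {suc n} f≡₂g = ≡₂-+ (f≡₂g zero) (Σᶠ-cong-≡₂ (f≡₂g ∘ suc))

det-cong-≡₂ : ∀ n {A B : Matrix n} → (∀ i j → A i j ≡₂ B i j) → det n A ≡₂ det n B
det-cong-≡₂ zero    A≡₂B = ≡₂-refl
det-cong-≡₂ (suc n) A≡₂B = Σᶠ-cong-≡₂ λ j →
  ≡₂-* (≡₂-* (≡₂-refl {sgn (toℕ j)}) (A≡₂B zero j))
       (det-cong-≡₂ n (λ r s → A≡₂B (suc r) (punchIn j s)))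

Odd-resp-≡₂ : ∀ {a b} → Odd a → a ≡₂ b → Odd b
Odd-resp-≡₂ {b = b} (k , refl) (mod2 l b+2l≡2k+1) = k - l , solve-for-b b k l b+2l≡2k+1
  where
  solve-for-b : ∀ b k l → + 2 * k + 1ℤ ≡ b + + 2 * l → b ≡ + 2 * (k - l) + 1ℤ
  solve-for-b b k l eq = begin
    b                           ≡⟨ isolate b l ⟩
    b + + 2 * l - + 2 * l       ≡⟨ cong (_- + 2 * l) eq ⟨
    + 2 * k + 1ℤ - + 2 * l      ≡⟨ collect k l ⟩
    + 2 * (k - l) + 1ℤ          ∎
    where
    isolate : ∀ b l → b ≡ b + + 2 * l - + 2 * l
    isolate = solve-∀
    collect : ∀ k l → + 2 * k + 1ℤ - + 2 * l ≡ + 2 * (k - l) + 1ℤ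
    collect = solve-∀

detℕ : ∀ n → (ℕ → ℕ → ℤ) → ℤ
detℕ n M = det n (λ i j → M (toℕ i) (toℕ j))

detℕ-cong : ∀ n {M N : ℕ → ℕ → ℤ} → (∀ i j → i < n → M i j ≡ N i j) → detℕ n M ≡ detℕ n N
detℕ-cong n M≗N = det-cong n (λ i j → M≗N (toℕ i) (toℕ j) (Fin.toℕ<n i))

detℕ-addRow : ∀ n {M N : ℕ → ℕ → ℤ} {r s} t → r < n → s < n → r ≢ s →
  (∀ i j → i ≢ r → N i j ≡ M i j) → (∀ j → N r j ≡ M r j + t * M s j) → detℕ n N ≡ detℕ n M
detℕ-addRow n {M} {N} {r} {s} t r<n s<n r≢s others rowᵣ =
  trans (det-cong n N≗) (det-addRow n (λ i j → M (toℕ i) (toℕ j)) t r′≢s′)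
  where
  r′ s′ : Fin n
  r′ = fromℕ< r<n
  s′ = fromℕ< s<n
  r′≢s′ : r′ ≢ s′
  r′≢s′ r′≡s′ = r≢s (begin
    r        ≡⟨ Fin.toℕ-fromℕ< r<n ⟨
    toℕ r′   ≡⟨ cong toℕ r′≡s′ ⟩
    toℕ s′   ≡⟨ Fin.toℕ-fromℕ< s<n ⟩
    s        ∎)
  N≗ : ∀ i j → N (toℕ i) (toℕ j) ≡
    replaceRow (λ i j → M (toℕ i) (toℕ j)) r′
               (λ j → M (toℕ r′) (toℕ j) + t * M (toℕ s′) (toℕ j)) i j
  N≗ i j with i ≟ r′
  ... | yes refl rewrite Fin.toℕ-fromℕ< r<n | Fin.toℕ-fromℕ< s<n = rowᵣ (toℕ j)
  ... | no i≢r′ = others (toℕ i) (toℕ j) λ i≡r →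
    i≢r′ (Fin.toℕ-injective (trans i≡r (sym (Fin.toℕ-fromℕ< r<n))))

rowDiff : (ℕ → ℕ → ℤ) → ℕ → ℕ → ℤ
rowDiff M zero    j = M zero j
rowDiff M (suc i) j = M (suc i) j - M i j

colDiff : (ℕ → ℕ → ℤ) → ℕ → ℕ → ℤ
colDiff M i zero    = M i zero
colDiff M i (suc j) = M i (suc j) - M i j

-- Rows are restored one at a time from the top, so each row operation uses an unaltered row.
detℕ-rowDiff : ∀ n (M : ℕ → ℕ → ℤ) → detℕ n (rowDiff M) ≡ detℕ n M
detℕ-rowDiff n M = trans (restoreRows n ℕ.≤-refl) (detℕ-cong n (λ i j i<n → restored n i j i<n))
  where
  partial : ℕ → ℕ → ℕ → ℤ
  partial m i j with i <? m
  ... | yes _ = M i j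
  ... | no  _ = rowDiff M i j

  restored : ∀ m i j → i < m → partial m i j ≡ M i j
  restored m i j i<m with i <? m
  ... | yes _   = refl
  ... | no  i≮m = contradiction i<m i≮m

  unrestored : ∀ m i j → ¬ i < m → partial m i j ≡ rowDiff M i j
  unrestored m i j i≮m with i <? m
  ... | yes i<m = contradiction i<m i≮m
  ... | no  _   = refl

  otherRows : ∀ k i j → i ≢ suc k → partial (suc k) i j ≡ partial (suc (suc k)) i j
  otherRows k i j i≢k+1 with ℕ.<-cmp i (suc k)
  ... | tri< i<k+1 _ _ = trans (restored _ i j i<k+1) (sym (restored _ i j (ℕ.m<n⇒m<1+n i<k+1)))
  ... | tri≈ _ i≡k+1 _ = contradiction i≡k+1 i≢k+1
  ... | tri> _ _ k+1<i =
    trans (unrestored _ i j (ℕ.<⇒≯ k+1<i)) (sym (unrestored _ i j (ℕ.<⇒≱ k+1<i ∘ ℕ.≤-pred)))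

  restoreRow : ∀ m → m < n → detℕ n (partial m) ≡ detℕ n (partial (suc m))
  restoreRow zero _ = detℕ-cong n {partial 0} {partial 1} λ where
    zero    j _ → trans (unrestored 0 0 j λ ()) (sym (restored 1 0 j z<s))
    (suc i) j _ → trans (unrestored 0 (suc i) j λ ()) (sym (unrestored 1 (suc i) j λ { (s≤s ()) }))
  restoreRow (suc k) k+1<n =
    detℕ-addRow n (- 1ℤ) k+1<n (ℕ.<-trans (ℕ.n<1+n k) k+1<n)
      (λ k+1≡k → ℕ.<⇒≢ (ℕ.n<1+n k) (sym k+1≡k)) (otherRows k) λ j → begin
          partial (suc k) (suc k) j
        ≡⟨ unrestored _ (suc k) j (ℕ.n≮n (suc k)) ⟩
          M (suc k) j - M k j
        ≡⟨ cong (_+_ (M (suc k) j)) (ℤ.-1*i≡-i (M k j)) ⟨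
          M (suc k) j + - 1ℤ * M k j
        ≡⟨ cong₂ (λ x y → x + - 1ℤ * y) (restored _ (suc k) j (ℕ.n<1+n (suc k)))
                                        (restored _ k j (ℕ.m<n⇒m<1+n (ℕ.n<1+n k))) ⟨
          partial (suc (suc k)) (suc k) j + - 1ℤ * partial (suc (suc k)) k j
        ∎

  restoreRows : ∀ m → m ≤ n → detℕ n (rowDiff M) ≡ detℕ n (partial m)
  restoreRows zero    _   = detℕ-cong n {rowDiff M} {partial 0} (λ i j _ → sym (unrestored 0 i j λ ()))
  restoreRows (suc m) m<n = trans (restoreRows m (ℕ.<⇒≤ m<n)) (restoreRow m m<n)

detℕ-transpose : ∀ n (M : ℕ → ℕ → ℤ) → detℕ n (λ i j → M j i) ≡ detℕ n M
detℕ-transpose n M = det-transpose n (λ i j → M (toℕ i) (toℕ j))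

detℕ-colDiff : ∀ n (M : ℕ → ℕ → ℤ) → detℕ n (colDiff M) ≡ detℕ n M
detℕ-colDiff n M = begin
  detℕ n (colDiff M)                  ≡⟨ det-cong n (λ i j → colDiff≡rowDiffᵀ (toℕ i) (toℕ j)) ⟩
  detℕ n (λ i j → rowDiff Mᵀ j i)     ≡⟨ detℕ-transpose n (rowDiff Mᵀ) ⟩
  detℕ n (rowDiff Mᵀ)                 ≡⟨ detℕ-rowDiff n Mᵀ ⟩
  detℕ n Mᵀ                           ≡⟨ detℕ-transpose n M ⟩
  detℕ n M                            ∎
  where
  Mᵀ : ℕ → ℕ → ℤ
  Mᵀ i j = M j i
  colDiff≡rowDiffᵀ : ∀ i j → colDiff M i j ≡ rowDiff Mᵀ j i
  colDiff≡rowDiffᵀ i zero    = refl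
  colDiff≡rowDiffᵀ i (suc j) = refl

-- Hankel determinants

Hankel : (ℕ → ℤ) → ℕ → ℕ → ℤ
Hankel a i j = a (i +ℕ j)

Δ : (ℕ → ℤ) → ℕ → ℤ
Δ e k = e k - e (suc k)

Δ-diff-≡₂ : ∀ e k → Δ e (suc k) - Δ e k ≡₂ e (suc (suc k)) - e k
Δ-diff-≡₂ e k = mod2 (e (suc k) - e (suc (suc k))) (regroup (e k) (e (suc k)) (e (suc (suc k))))
  where
  regroup : ∀ x y z → (y - z) - (x - y) ≡ z - x + + 2 * (y - z)
  regroup = solve-∀

halvedHankel : (d e : ℕ → ℤ) → ℕ → ℕ → ℤ
halvedHankel d e zero    j = d j
halvedHankel d e (suc i) j = Δ e (i +ℕ j)

H-halve : (d e : ℕ → ℤ) → (∀ i → d i ≡ 1ℤ - + 2 * e i) → ∀ n →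
  H (suc n) d ≡ pow2 n * detℕ (suc n) (halvedHankel d e)
H-halve d e d≡1-2e n = begin
    H (suc n) d
  ≡⟨ detℕ-rowDiff (suc n) (Hankel d) ⟨
    detℕ (suc n) (rowDiff (Hankel d))
  ≡⟨ det-*2-tail n {λ i j → rowDiff (Hankel d) (toℕ i) (toℕ j)}
                   {λ i j → halvedHankel d e (toℕ i) (toℕ j)} {1ℤ}
       (λ j → sym (ℤ.*-identityˡ (d (toℕ j)))) (λ i j → rowDiff≡2Δ (toℕ i) (toℕ j)) ⟩
    1ℤ * pow2 n * detℕ (suc n) (halvedHankel d e)
  ≡⟨ cong (_* detℕ (suc n) (halvedHankel d e)) (ℤ.*-identityˡ (pow2 n)) ⟩
    pow2 n * detℕ (suc n) (halvedHankel d e)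
  ∎
  where
  halve : ∀ x y → (1ℤ - + 2 * y) - (1ℤ - + 2 * x) ≡ + 2 * (x - y)
  halve = solve-∀
  rowDiff≡2Δ : ∀ i j → rowDiff (Hankel d) (suc i) j ≡ + 2 * Δ e (i +ℕ j)
  rowDiff≡2Δ i j = trans (cong₂ _-_ (d≡1-2e (suc (i +ℕ j))) (d≡1-2e (i +ℕ j)))
                         (halve (e (i +ℕ j)) (e (suc (i +ℕ j))))

halvedHankel-≡₂ : (d e c : ℕ → ℤ) → (∀ i → d i ≡ 1ℤ - + 2 * e i) →
  (∀ k → c k ≡₂ e (suc (suc k)) - e k) → ∀ n → detℕ (suc n) (halvedHankel d e) ≡₂ H n c
halvedHankel-≡₂ d e c d≡1-2e c≡₂ n =
  ≡₂-trans (≡⇒≡₂ (sym (detℕ-colDiff (suc n) (halvedHankel d e))))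
    (≡₂-trans (det-cong-≡₂ (suc n) (λ i j → M≡₂K (toℕ i) (toℕ j)))
      (≡⇒≡₂ (det-unitRow₀ n {λ i j → K (toℕ i) (toℕ j)} refl (λ _ → refl))))
  where
  M : ℕ → ℕ → ℤ
  M = colDiff (halvedHankel d e)
  K : ℕ → ℕ → ℤ
  K zero    zero    = 1ℤ
  K zero    (suc j) = 0ℤ
  K (suc i) zero    = M (suc i) zero
  K (suc i) (suc j) = c (i +ℕ j)
  M≡₂K : ∀ i j → M i j ≡₂ K i j
  M≡₂K zero    zero    = mod2 (- e 0) (trans (d≡1-2e 0) (odd (e 0)))
    where
    odd : ∀ x → 1ℤ - + 2 * x ≡ 1ℤ + + 2 * - x
    odd = solve-∀
  M≡₂K zero    (suc j) = mod2 (e j - e (suc j))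
    (trans (cong₂ _-_ (d≡1-2e (suc j)) (d≡1-2e j)) (even (e j) (e (suc j))))
    where
    even : ∀ x y → (1ℤ - + 2 * y) - (1ℤ - + 2 * x) ≡ 0ℤ + + 2 * (x - y)
    even = solve-∀
  M≡₂K (suc i) zero    = ≡₂-refl
  M≡₂K (suc i) (suc j) rewrite ℕ.+-suc i j =
    ≡₂-trans (Δ-diff-≡₂ e (i +ℕ j)) (≡₂-sym (c≡₂ (i +ℕ j)))

PM1Seq⇒bits : ∀ {d} → PM1Seq d → ∃ λ e → ∀ i → d i ≡ 1ℤ - + 2 * e i
PM1Seq⇒bits pm = (λ i → bit (pm i)) , λ i → ≡1-2bit (pm i)
  where
  bit : ∀ {x} → x ≡ 1ℤ ⊎ x ≡ - 1ℤ → ℤ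
  bit (inj₁ _) = 0ℤ
  bit (inj₂ _) = 1ℤ
  ≡1-2bit : ∀ {x} (p : x ≡ 1ℤ ⊎ x ≡ - 1ℤ) → x ≡ 1ℤ - + 2 * bit p
  ≡1-2bit (inj₁ x≡1)  = x≡1
  ≡1-2bit (inj₂ x≡-1) = x≡-1

Related⇒≡₂ : (d c e : ℕ → ℤ) → (∀ i → d i ≡ 1ℤ - + 2 * e i) → Related d c →
  ∀ k → c k ≡₂ e (suc (suc k)) - e k
Related⇒≡₂ d c e d≡1-2e rel k with ∣ᵤ⇒∣ {+ 4} {+ 2 * c k - (d k - d (suc (suc k)))} (rel k)
... | divides q 2c-Δd≡4q = mod2 q (ℤ.*-cancelˡ-≡ (+ 2) (c k) (Δe + + 2 * q) (begin
    + 2 * c k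
  ≡⟨ split (c k) (e k) (e (suc (suc k))) ⟩
    + 2 * c k - ((1ℤ - + 2 * e k) - (1ℤ - + 2 * e (suc (suc k)))) + + 2 * Δe
  ≡⟨ cong₂ (λ x y → + 2 * c k - (x - y) + + 2 * Δe) (d≡1-2e k) (d≡1-2e (suc (suc k))) ⟨
    + 2 * c k - (d k - d (suc (suc k))) + + 2 * Δe
  ≡⟨ cong (λ x → x + + 2 * Δe) 2c-Δd≡4q ⟩
    q * + 4 + + 2 * Δe
  ≡⟨ regroup q Δe ⟩
    + 2 * (Δe + + 2 * q)
  ∎))
  where
  Δe : ℤ
  Δe = e (suc (suc k)) - e k
  split : ∀ c x z → + 2 * c ≡ + 2 * c - ((1ℤ - + 2 * x) - (1ℤ - + 2 * z)) + + 2 * (z - x)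
  split = solve-∀
  regroup : ∀ q y → q * + 4 + + 2 * y ≡ + 2 * (y + + 2 * q)
  regroup = solve-∀

pow2-cancelˡ : ∀ m {x y} → pow2 m * x ≡ pow2 m * y → x ≡ y
pow2-cancelˡ zero    {x} {y} eq = trans (sym (ℤ.*-identityˡ x)) (trans eq (ℤ.*-identityˡ y))
pow2-cancelˡ (suc m) {x} {y} eq = pow2-cancelˡ m (ℤ.*-cancelˡ-≡ (+ 2) _ _
  (trans (sym (ℤ.*-assoc (+ 2) (pow2 m) x)) (trans eq (ℤ.*-assoc (+ 2) (pow2 m) y))))

ApwenianPM⇔Odd : ∀ {d} (X : ℕ → ℤ) → (∀ n → H (suc n) d ≡ pow2 n * X n) →
  ApwenianPM d ⇔ (∀ n → Odd (X n))
ApwenianPM⇔Odd {d} X H≡2ⁿX = mk⇔ (λ apw n → Odd-X (apw n)) (λ odd n → X n , H≡2ⁿX n , odd n)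
  where
  Odd-X : ∀ {n} → (∃ λ q → H (suc n) d ≡ pow2 n * q × Odd q) → Odd (X n)
  Odd-X {n} (q , H≡2ⁿq , odd-q) = subst Odd (pow2-cancelˡ n (trans (sym H≡2ⁿq) (H≡2ⁿX n))) odd-q

Apwenian01⇔Odd : ∀ {c} (X : ℕ → ℤ) → (∀ n → X n ≡₂ H n c) →
  Apwenian01 c ⇔ (∀ n → Odd (X n))
Apwenian01⇔Odd {c} X X≡₂H = mk⇔
  (λ apw n → Odd-resp-≡₂ (Odd-H apw n) (≡₂-sym (X≡₂H n)))
  (λ odd n → Odd-resp-≡₂ (odd (suc n)) (X≡₂H (suc n)))
  where
  Odd-H : Apwenian01 c → ∀ n → Odd (H n c)
  Odd-H _   zero    = 0ℤ , refl
  Odd-H apw (suc n) = apw n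

lemma3p4 : (d c : ℕ → ℤ) → PM1Seq d → ZeroOneSeq c → Related d c →
    ApwenianPM d ⇔ Apwenian01 c
lemma3p4 d c pm _ rel with PM1Seq⇒bits pm
... | e , d≡1-2e = ⇔.trans
  (ApwenianPM⇔Odd {d} _ (H-halve d e d≡1-2e))
  (⇔.sym (Apwenian01⇔Odd {c} _ (halvedHankel-≡₂ d e c d≡1-2e c≡₂)))
  where
  c≡₂ : ∀ k → c k ≡₂ e (suc (suc k)) - e k
  c≡₂ = Related⇒≡₂ d c e d≡1-2e rel
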